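{- Let $G=(V,E)$ be an equidominating graph with equidominating structure $(w,t)$ and let $S\subseteq V$ be a stable set class and $C\subseteq V$ a clique class that see each other. Then $w(x)\ne w(y)$ for all $x\in S$ and all $y\in C$.
   Context: All graphs are finite, simple and undirected; $\mathbb{N}=\{1,2,\dots\}$. A minimal dominating set (mds) of $G=(V,E)$ is an inclusion-minimal set $D\subseteq V$ such that every vertex is in $D$ or adjacent to a vertex of $D$. An equidominating structure of $G$ is a pair $(w,t)$ with $t\in\mathbb{N}$, $w\colon V\to\mathbb{N}$, such that for all $D\subseteq V$: $D$ is an mds iff $\sum_{v\in D}w(v)=t$; $G$ is equidominating if such a structure exists. Two vertices $v,w$ are twins if $N(v)\setminus\{w\}=N(w)\setminus\{v\}$; the equivalence classes of this relation are twin classes. A twin class with at least two elements is a clique class if its vertices are pairwise adjacent and a stable set class if they are pairwise non-adjacent. Two twin classes see each other if every vertex of one is adjacent to every vertex of the other. -}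

module Defs where

open import Data.Nat using (ℕ; _≤_; _+_)
open import Data.Fin using (Fin)
open import Data.Fin.Subset using (Subset; _∈_; _⊂_; ∣_∣)
open import Data.Vec using (lookup)
open import Data.Bool using (if_then_else_)
open import Data.Product using (Σ; _×_; ∃; ∃-syntax)
open import Data.Sum using (_⊎_)
open import Relation.Binary.PropositionalEquality using (_≡_; _≢_)
open import Relation.Nullary using (¬_)
open import Function.Bundles using (_⇔_)

record Graph (n : ℕ) : Set₁ where
  field
    Adj   : Fin n → Fin n → Set
    sym   : ∀ {u v} → Adj u v → Adj v u
    irrefl : ∀ {v} → ¬ Adj v v
open Graph public

wsum : ∀ {n} → (Fin n → ℕ) → Subset n → ℕ
wsum {Data.Nat.zero} w D = 0
wsum {Data.Nat.suc n} w D =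
  (if lookup D Fin.zero then w Fin.zero else 0)
  + wsum (λ i → w (Fin.suc i)) (Data.Vec.tail D)
  where import Data.Fin as Fin
        import Data.Vec

Dominating : ∀ {n} → Graph n → Subset n → Set
Dominating G D = ∀ v → v ∈ D ⊎ (∃[ u ] (u ∈ D × Adj G u v))

IsMDS : ∀ {n} → Graph n → Subset n → Set
IsMDS G D = Dominating G D × (∀ D′ → D′ ⊂ D → ¬ Dominating G D′)

IsEquidominatingStructure : ∀ {n} → Graph n → (Fin n → ℕ) → ℕ → Set
IsEquidominatingStructure {n} G w t =
  (∀ v → 1 ≤ w v) × (1 ≤ t) × (∀ (D : Subset n) → IsMDS G D ⇔ (wsum w D ≡ t))

Twins : ∀ {n} → Graph n → Fin n → Fin n → Set
Twins G v w = ∀ u → (Adj G v u × u ≢ w) ⇔ (Adj G w u × u ≢ v)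

IsTwinClass : ∀ {n} → Graph n → Subset n → Set
IsTwinClass G S = ∃[ x ] (x ∈ S × (∀ y → y ∈ S ⇔ Twins G x y))

IsStableSetClass : ∀ {n} → Graph n → Subset n → Set
IsStableSetClass G S =
  IsTwinClass G S × (2 ≤ ∣ S ∣) × (∀ x y → x ∈ S → y ∈ S → ¬ Adj G x y)

IsCliqueClass : ∀ {n} → Graph n → Subset n → Set
IsCliqueClass G C =
  IsTwinClass G C × (2 ≤ ∣ C ∣) × (∀ x y → x ∈ C → y ∈ C → x ≢ y → Adj G x y)

SeeEachOther : ∀ {n} → Graph n → Subset n → Subset n → Set
SeeEachOther G A B = ∀ x y → x ∈ A → y ∈ B → Adj G x y

module Submission where

-- Suppose w(x) = w(y) and pick s ∈ S, c ∈ C with s ≢ x, c ≢ y.  Take an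
-- mds I containing x and no neighbour of x (an mds inside the set of
-- non-neighbours of x); I then also contains the non-adjacent twin s and
-- avoids y and c.  Exchanging x for y yields a set B of weight t, hence an
-- mds.  Exchanging one twin for another is a graph automorphism, so it
-- maps mds to mds; as the weight sum characterises mds, twins exchanged
-- this way have equal weight: w(c) = w(y) and w(s) = w(x).  Exchanging s
-- for c in B therefore gives a set Z of weight t, i.e. an mds, containing
-- the adjacent twins y and c -- but no mds contains two adjacent twins.

open import Defs
open import Data.Nat using (ℕ; _+_; _≤_; s≤s)
open import Data.Nat.Properties
  using (+-cancelʳ-≡; ≤-trans; ≤-reflexive; +-commutativeSemigroup)
open import Algebra.Properties.CommutativeSemigroup +-commutativeSemigroup
  using (x∙yz≈y∙xz)
open import Data.Fin using (Fin; zero; suc)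
open import Data.Fin.Properties using (_≟_)
open import Data.Fin.Subset using (Subset; _∈_; _∉_; _⊆_; _⊂_; ∣_∣; ⁅_⁆)
open import Data.Fin.Subset.Properties using (p⊆q⇒∣p∣≤∣q∣; ∣⁅x⁆∣≡1; x∈⁅x⁆)
open import Data.Fin.Subset.Induction using (⊂-wellFounded; Acc; acc)
open import Data.Fin.Permutation.Components using (transpose; transpose-inverse)
open import Data.Vec using (_∷_; lookup; tabulate; _[_]≔_)
open import Data.Vec.Properties
  using ( []=⇒lookup; lookup⇒[]=; lookup∘tabulate; tabulate∘lookup; tabulate-cong
        ; []≔-lookup; []≔-updates; []≔-minimal; lookup∘update; lookup∘update′)
open import Data.Bool using (Bool; true; false; not; if_then_else_)
open import Data.Product using (Σ; _×_; _,_; proj₁; ∃-syntax)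
open import Data.Sum using (_⊎_; inj₁; inj₂; [_,_]′)
open import Data.Empty using (⊥)
open import Function using (_∘_; id)
open import Function.Bundles using (_⇔_; mk⇔; Equivalence)
import Function.Properties.Equivalence as ⇔
open import Relation.Nullary using (¬_; Dec; yes; no; does; contradiction)
open import Relation.Nullary.Decidable using (dec-true; dec-false; _⊎-dec_)
open import Relation.Nullary.Decidable.Core using (¬¬-excluded-middle)
open import Relation.Binary.PropositionalEquality
  using (_≡_; _≢_; refl; trans; cong; subst; subst₂; module ≡-Reasoning)
  renaming (sym to ≡-sym)
open Equivalence using (to; from)

¬¬-finite-choice : ∀ {n} {P : Fin n → Set} → (∀ i → ¬ ¬ P i) → ¬ ¬ (∀ i → P i)
¬¬-finite-choice {ℕ.zero} ¬¬P ¬∀P = ¬∀P λ ()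
¬¬-finite-choice {ℕ.suc n} {P} ¬¬P ¬∀P =
  ¬¬P zero λ p₀ → ¬¬-finite-choice {n} {P ∘ suc} (¬¬P ∘ suc) λ ps →
    ¬∀P λ { zero → p₀ ; (suc i) → ps i }

another-member : ∀ {n} (S : Subset n) x → 2 ≤ ∣ S ∣ → x ∈ S →
                 ¬ ¬ (Σ (Fin n) λ s → s ∈ S × s ≢ x)
another-member S x two x∈S none =
  two≰one (≤-trans two (≤-trans (p⊆q⇒∣p∣≤∣q∣ S⊆⁅x⁆) (≤-reflexive (∣⁅x⁆∣≡1 x))))
  where
  S⊆⁅x⁆ : S ⊆ ⁅ x ⁆
  S⊆⁅x⁆ {z} z∈S with z ≟ x
  ... | yes refl = x∈⁅x⁆ x
  ... | no z≢x = contradiction (z , z∈S , z≢x) none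
  two≰one : ¬ (2 ≤ 1)
  two≰one (s≤s ())

update-current : ∀ {n} (D : Subset n) b {β} → lookup D b ≡ β → D [ b ]≔ β ≡ D
update-current D b refl = []≔-lookup D b

∉⇒lookup≡false : ∀ {n} {D : Subset n} {b} → b ∉ D → lookup D b ≡ false
∉⇒lookup≡false {D = D} {b} b∉D with lookup D b in eq
... | true  = contradiction (lookup⇒[]= b D eq) b∉D
... | false = refl

∈-update⇒∈ : ∀ {n} {D : Subset n} {v b β} → v ≢ b → v ∈ D [ b ]≔ β → v ∈ D
∈-update⇒∈ {D = D} {v} {b} {β} v≢b v∈ =
  lookup⇒[]= v D (trans (≡-sym (lookup∘update′ v≢b D β)) ([]=⇒lookup v∈))

∉-removed : ∀ {n} (D : Subset n) b → b ∉ D [ b ]≔ false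
∉-removed D b b∈ with trans (≡-sym ([]=⇒lookup b∈)) (lookup∘update b D false)
... | ()

removal-⊆ : ∀ {n} (D : Subset n) b → D [ b ]≔ false ⊆ D
removal-⊆ D b {v} v∈ with v ≟ b
... | yes refl = contradiction v∈ (∉-removed D b)
... | no v≢b   = ∈-update⇒∈ v≢b v∈

removal-⊂ : ∀ {n} {D : Subset n} {b} → b ∈ D → D [ b ]≔ false ⊂ D
removal-⊂ {D = D} {b} b∈D = removal-⊆ D b , b , b∈D , ∉-removed D b

exchange : ∀ {n} → Subset n → Fin n → Fin n → Subset n
exchange D a b = (D [ a ]≔ false) [ b ]≔ true

∈-exchange-new : ∀ {n} (D : Subset n) a b → b ∈ exchange D a b
∈-exchange-new D a b = []≔-updates (D [ a ]≔ false) b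

∉-exchange-old : ∀ {n} (D : Subset n) {a b} → a ≢ b → a ∉ exchange D a b
∉-exchange-old D {a} a≢b = ∉-removed D a ∘ ∈-update⇒∈ a≢b

∈-exchange-kept : ∀ {n} {D : Subset n} {a b v} →
                  v ∈ D → v ≢ a → v ≢ b → v ∈ exchange D a b
∈-exchange-kept {D = D} {a} {b} {v} v∈D v≢a v≢b =
  []≔-minimal (D [ a ]≔ false) v b v≢b ([]≔-minimal D v a v≢a v∈D)

∉-exchange-kept : ∀ {n} {D : Subset n} {a b v} →
                  v ∉ D → v ≢ b → v ∉ exchange D a b
∉-exchange-kept {D = D} {a} v∉D v≢b = v∉D ∘ removal-⊆ D a ∘ ∈-update⇒∈ v≢b

wsum-update : ∀ {n} (w : Fin n → ℕ) (D : Subset n) b →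
              wsum w (D [ b ]≔ true) ≡ w b + wsum w (D [ b ]≔ false)
wsum-update w (β ∷ D) zero    = refl
wsum-update w (β ∷ D) (suc b) = begin
  c + wsum (w ∘ suc) (D [ b ]≔ true)                   ≡⟨ cong (c +_) (wsum-update (w ∘ suc) D b) ⟩
  c + (w (suc b) + wsum (w ∘ suc) (D [ b ]≔ false))   ≡⟨ x∙yz≈y∙xz c (w (suc b)) _ ⟩
  w (suc b) + (c + wsum (w ∘ suc) (D [ b ]≔ false))   ∎
  where
  open ≡-Reasoning
  c = if β then w zero else 0

wsum-insert : ∀ {n} (w : Fin n → ℕ) {D : Subset n} {b} →
              b ∉ D → wsum w (D [ b ]≔ true) ≡ w b + wsum w D
wsum-insert w {D} {b} b∉D =
  trans (wsum-update w D b) (cong (λ E → w b + wsum w E) (update-current D b (∉⇒lookup≡false b∉D)))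

wsum-remove : ∀ {n} (w : Fin n → ℕ) {D : Subset n} {a} →
              a ∈ D → wsum w D ≡ w a + wsum w (D [ a ]≔ false)
wsum-remove w {D} {a} a∈D =
  trans (cong (wsum w) (≡-sym (update-current D a ([]=⇒lookup a∈D)))) (wsum-update w D a)

module _ {n} (G : Graph n) where

  adj⇒≢ : ∀ {u v} → Adj G u v → u ≢ v
  adj⇒≢ adj refl = irrefl G adj

  twin-adj : ∀ {a b v} → Twins G a b → Adj G a v → v ≢ b → Adj G b v
  twin-adj {v = v} a~b adj v≢b = proj₁ (to (a~b v) (adj , v≢b))

  twins-sym : ∀ {a b} → Twins G a b → Twins G b a
  twins-sym a~b u = ⇔.sym (a~b u)

  -- One direction of transitivity; the vertex u = b needs a separate argument.
  twins-step : ∀ {a b c} → Twins G a b → Twins G b c →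
               ∀ u → Adj G a u × u ≢ c → Adj G c u × u ≢ a
  twins-step {a} {b} {c} a~b b~c u (a-u , u≢c) with u ≟ b
  ... | no u≢b  = let b-u , u≢a = to (a~b u) (a-u , u≢b)
                  in  twin-adj b~c b-u u≢c , u≢a
  ... | yes refl = c-b , adj⇒≢ (sym G a-u)
    where
    c-b : Adj G c b
    c-b with a ≟ c
    ... | yes refl = a-u
    ... | no a≢c   = sym G (twin-adj a~b (sym G (twin-adj b~c (sym G a-u) a≢c))
                                     (λ c≡b → u≢c (≡-sym c≡b)))

  twins-trans : ∀ {a b c} → Twins G a b → Twins G b c → Twins G a c
  twins-trans a~b b~c u =
    mk⇔ (twins-step a~b b~c u) (twins-step (twins-sym b~c) (twins-sym a~b) u)

  class-twins : ∀ {S a b} → IsTwinClass G S → a ∈ S → b ∈ S → Twins G a b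
  class-twins (_ , _ , members) a∈S b∈S =
    twins-trans (twins-sym (to (members _) a∈S)) (to (members _) b∈S)

-- Automorphisms map minimal dominating sets to minimal dominating sets

record Automorphism {n} (G : Graph n) : Set where
  field
    σ σ⁻¹   : Fin n → Fin n
    σ∘σ⁻¹   : ∀ v → σ (σ⁻¹ v) ≡ v
    σ⁻¹∘σ   : ∀ v → σ⁻¹ (σ v) ≡ v
    σ-adj   : ∀ {u v} → Adj G u v → Adj G (σ u) (σ v)
    σ⁻¹-adj : ∀ {u v} → Adj G u v → Adj G (σ⁻¹ u) (σ⁻¹ v)

  inverse : Automorphism G
  inverse = record { σ = σ⁻¹ ; σ⁻¹ = σ ; σ∘σ⁻¹ = σ⁻¹∘σ ; σ⁻¹∘σ = σ∘σ⁻¹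
                   ; σ-adj = σ⁻¹-adj ; σ⁻¹-adj = σ-adj }

preimage : ∀ {n} → (Fin n → Fin n) → Subset n → Subset n
preimage f D = tabulate (lookup D ∘ f)

∈⇔lookup : ∀ {n} {D : Subset n} {v} → v ∈ D ⇔ lookup D v ≡ true
∈⇔lookup {D = D} {v} = mk⇔ []=⇒lookup (lookup⇒[]= v D)

∈-tabulate : ∀ {n} {f : Fin n → Bool} {v} → v ∈ tabulate f ⇔ f v ≡ true
∈-tabulate {f = f} {v} =
  ⇔.trans ∈⇔lookup (mk⇔ (trans (≡-sym (lookup∘tabulate f v))) (trans (lookup∘tabulate f v)))

∈-preimage : ∀ {n} {f : Fin n → Fin n} {D v} → v ∈ preimage f D ⇔ f v ∈ D
∈-preimage = ⇔.trans ∈-tabulate (⇔.sym ∈⇔lookup)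

module _ {n} {G : Graph n} (φ : Automorphism G) where
  open Automorphism φ

  -- A vertex dominated by u ∈ D is dominated by σ⁻¹ u in the preimage.
  preimage-dominating : (D : Subset n) → Dominating G D → Dominating G (preimage σ D)
  preimage-dominating D dom v with dom (σ v)
  ... | inj₁ σv∈D = inj₁ (from ∈-preimage σv∈D)
  ... | inj₂ (u , u∈D , u-σv) =
    inj₂ (σ⁻¹ u , from ∈-preimage (subst (_∈ D) (≡-sym (σ∘σ⁻¹ u)) u∈D)
                , subst (Adj G (σ⁻¹ u)) (σ⁻¹∘σ v) (σ⁻¹-adj u-σv))

module _ {n} {G : Graph n} (φ : Automorphism G) where
  open Automorphism φ

  -- Minimality transfers because the preimage under σ⁻¹ undoes the one under σ.
  preimage-mds : (D : Subset n) → IsMDS G D → IsMDS G (preimage σ D)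
  preimage-mds D (dom , minimal) =
    preimage-dominating φ D dom ,
    λ { E (E⊆ , z , z∈ , z∉E) E-dom →
          minimal (preimage σ⁻¹ E)
            ( (λ v∈ → subst (_∈ D) (σ∘σ⁻¹ _) (to ∈-preimage (E⊆ (to ∈-preimage v∈))))
            , σ z , to ∈-preimage z∈
            , (λ σz∈ → z∉E (subst (_∈ E) (σ⁻¹∘σ z) (to ∈-preimage σz∈))) )
            (preimage-dominating inverse E E-dom) }

-- Exchanging twins is an automorphism

record Swaps {n} (σ : Fin n → Fin n) (p q : Fin n) : Set where
  field
    σp      : σ p ≡ q
    σq      : σ q ≡ p
    σ-fixes : ∀ {k} → k ≢ p → k ≢ q → σ k ≡ k

swaps-sym : ∀ {n} {σ : Fin n → Fin n} {p q} → Swaps σ p q → Swaps σ q p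
swaps-sym s = record { σp = σq ; σq = σp ; σ-fixes = λ k≢q k≢p → σ-fixes k≢p k≢q }
  where open Swaps s

transpose-swaps : ∀ {n} (p q : Fin n) → Swaps (transpose p q) p q
transpose-swaps p q = record { σp = transpose-p ; σq = transpose-q ; σ-fixes = transpose-fixes }
  where
  transpose-p : transpose p q p ≡ q
  transpose-p rewrite dec-true (p ≟ p) refl = refl
  transpose-q : transpose p q q ≡ p
  transpose-q with q ≟ p
  ... | yes q≡p = q≡p
  ... | no _ rewrite dec-true (q ≟ q) refl = refl
  transpose-fixes : ∀ {k} → k ≢ p → k ≢ q → transpose p q k ≡ k
  transpose-fixes {k} k≢p k≢q rewrite dec-false (k ≟ p) k≢p | dec-false (k ≟ q) k≢q = refl

module _ {n} (G : Graph n) {σ : Fin n → Fin n} where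

  swap-edge-at-twin : ∀ {p q v} → Twins G p q → Swaps σ p q → Adj G p v → Adj G q (σ v)
  swap-edge-at-twin {p} {q} {v} p~q s p-v with v ≟ q
  ... | yes refl = subst (Adj G q) (≡-sym (Swaps.σq s)) (sym G p-v)
  ... | no v≢q   = subst (Adj G q) (≡-sym (Swaps.σ-fixes s (adj⇒≢ G p-v ∘ ≡-sym) v≢q))
                         (twin-adj G p~q p-v v≢q)

  swap-edge-at-pair : ∀ {p q c v} → Twins G p q → Swaps σ p q →
                      c ≡ p ⊎ c ≡ q → Adj G c v → Adj G (σ c) (σ v)
  swap-edge-at-pair p~q s (inj₁ refl) c-v =
    subst (λ z → Adj G z _) (≡-sym (Swaps.σp s)) (swap-edge-at-twin p~q s c-v)
  swap-edge-at-pair p~q s (inj₂ refl) c-v =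
    subst (λ z → Adj G z _) (≡-sym (Swaps.σq s))
          (swap-edge-at-twin (twins-sym G p~q) (swaps-sym s) c-v)

  swap-preserves-adj : ∀ {p q} → Twins G p q → Swaps σ p q →
                       ∀ {u v} → Adj G u v → Adj G (σ u) (σ v)
  swap-preserves-adj {p} {q} p~q s {u} {v} u-v
    with (u ≟ p) ⊎-dec (u ≟ q) | (v ≟ p) ⊎-dec (v ≟ q)
  ... | yes u∈pq | _        = swap-edge-at-pair p~q s u∈pq u-v
  ... | no _     | yes v∈pq = sym G (swap-edge-at-pair p~q s v∈pq (sym G u-v))
  ... | no u∉pq  | no v∉pq  = subst₂ (Adj G) (≡-sym (fixed u∉pq)) (≡-sym (fixed v∉pq)) u-v
    where
    fixed : ∀ {k} → ¬ (k ≡ p ⊎ k ≡ q) → σ k ≡ k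
    fixed k∉pq = Swaps.σ-fixes s (k∉pq ∘ inj₁) (k∉pq ∘ inj₂)

twin-transposition : ∀ {n} (G : Graph n) {a b} → Twins G a b → Automorphism G
twin-transposition G {a} {b} a~b = record
  { σ       = transpose a b
  ; σ⁻¹     = transpose b a
  ; σ∘σ⁻¹   = λ _ → transpose-inverse a b
  ; σ⁻¹∘σ   = λ _ → transpose-inverse b a
  ; σ-adj   = swap-preserves-adj G a~b (transpose-swaps a b)
  ; σ⁻¹-adj = swap-preserves-adj G (twins-sym G a~b) (transpose-swaps b a)
  }

exchange-is-preimage : ∀ {n} {D : Subset n} {a b} → a ∈ D → b ∉ D →
                       exchange D a b ≡ preimage (transpose a b) D
exchange-is-preimage {D = D} {a} {b} a∈D b∉D =
  trans (≡-sym (tabulate∘lookup (exchange D a b)))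
        (tabulate-cong (λ v → pointwise v (v ≟ a) (v ≟ b)))
  where
  open Swaps (transpose-swaps a b)
  open ≡-Reasoning
  a≢b : a ≢ b
  a≢b refl = b∉D a∈D
  pointwise : ∀ v → Dec (v ≡ a) → Dec (v ≡ b) →
              lookup (exchange D a b) v ≡ lookup D (transpose a b v)
  pointwise v (yes refl) _ = begin
    lookup (exchange D a b) a   ≡⟨ lookup∘update′ a≢b (D [ a ]≔ false) true ⟩
    lookup (D [ a ]≔ false) a   ≡⟨ lookup∘update a D false ⟩
    false                       ≡⟨ ≡-sym (∉⇒lookup≡false b∉D) ⟩
    lookup D b                  ≡⟨ cong (lookup D) (≡-sym σp) ⟩
    lookup D (transpose a b a)  ∎
  pointwise v (no _) (yes refl) = begin
    lookup (exchange D a b) b   ≡⟨ lookup∘update b (D [ a ]≔ false) true ⟩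
    true                        ≡⟨ ≡-sym ([]=⇒lookup a∈D) ⟩
    lookup D a                  ≡⟨ cong (lookup D) (≡-sym σq) ⟩
    lookup D (transpose a b b)  ∎
  pointwise v (no v≢a) (no v≢b) = begin
    lookup (exchange D a b) v   ≡⟨ lookup∘update′ v≢b (D [ a ]≔ false) true ⟩
    lookup (D [ a ]≔ false) v   ≡⟨ lookup∘update′ v≢a D false ⟩
    lookup D v                  ≡⟨ cong (lookup D) (≡-sym (σ-fixes v≢a v≢b)) ⟩
    lookup D (transpose a b v)  ∎

twin-exchange-mds : ∀ {n} (G : Graph n) {D : Subset n} {a b} → Twins G a b →
                    IsMDS G D → a ∈ D → b ∉ D → IsMDS G (exchange D a b)
twin-exchange-mds G {D} a~b D-mds a∈D b∉D =
  subst (IsMDS G) (≡-sym (exchange-is-preimage a∈D b∉D))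
        (preimage-mds (twin-transposition G a~b) D D-mds)

-- The twin b is redundant: whatever b dominates, a dominates as well.
adjacent-twins-not-in-mds : ∀ {n} (G : Graph n) {D : Subset n} {a b} →
  Twins G a b → Adj G a b → IsMDS G D → a ∈ D → b ∈ D → ⊥
adjacent-twins-not-in-mds G {D} {a} {b} a~b a-b (dom , minimal) a∈D b∈D =
  minimal (D [ b ]≔ false) (removal-⊂ b∈D) still-dominating
  where
  kept : ∀ {v} → v ∈ D → v ≢ b → v ∈ D [ b ]≔ false
  kept {v} v∈D v≢b = []≔-minimal D v b v≢b v∈D
  a∈E : a ∈ D [ b ]≔ false
  a∈E = kept a∈D (adj⇒≢ G a-b)
  still-dominating : Dominating G (D [ b ]≔ false)
  still-dominating v with dom v
  ... | inj₁ v∈D with v ≟ b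
  ...   | yes refl = inj₂ (a , a∈E , a-b)
  ...   | no v≢b   = inj₁ (kept v∈D v≢b)
  still-dominating v | inj₂ (u , u∈D , u-v) with u ≟ b
  ...   | no u≢b   = inj₂ (u , kept u∈D u≢b , u-v)
  ...   | yes refl with v ≟ a
  ...     | yes refl = inj₁ a∈E
  ...     | no v≢a   = inj₂ (a , a∈E , twin-adj G (twins-sym G a~b) u-v v≢a)

module _ {n} (G : Graph n) where

  mds-within : (D : Subset n) → Dominating G D → ¬ ¬ (∃[ I ] (I ⊆ D × IsMDS G I))
  mds-within D = shrink D (⊂-wellFounded D)
    where
    shrink : ∀ D → Acc _⊂_ D → Dominating G D → ¬ ¬ (∃[ I ] (I ⊆ D × IsMDS G I))
    shrink D (acc smaller) dom none =
      ¬¬-excluded-middle {A = ∃[ D′ ] (D′ ⊂ D × Dominating G D′)} λ where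
        (yes (D′ , D′⊂D , dom′)) → shrink D′ (smaller D′⊂D) dom′ λ (I , I⊆D′ , I-mds) →
          none (I , (λ v∈I → proj₁ D′⊂D (I⊆D′ v∈I)) , I-mds)
        (no no-smaller) → none (D , id , dom , λ D′ D′⊂D dom′ → no-smaller (D′ , D′⊂D , dom′))

  non-neighbours : ∀ x → (∀ v → Dec (Adj G x v)) → Subset n
  non-neighbours x adj? = tabulate (λ v → not (does (adj? v)))

  ∈-non-neighbours : ∀ {x} adj? {v} → v ∈ non-neighbours x adj? ⇔ (¬ Adj G x v)
  ∈-non-neighbours adj? {v} = ⇔.trans ∈-tabulate (by-decision (adj? v))
    where
    by-decision : ∀ {P} (d : Dec P) → (not (does d) ≡ true) ⇔ (¬ P)
    by-decision (yes p) = mk⇔ (λ ()) (λ ¬p → contradiction p ¬p)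
    by-decision (no ¬p) = mk⇔ (λ _ → ¬p) (λ _ → refl)

  -- x dominates its neighbours and every other vertex dominates itself.
  non-neighbours-dominating : ∀ x adj? → Dominating G (non-neighbours x adj?)
  non-neighbours-dominating x adj? v with adj? v
  ... | yes x-v = inj₂ (x , from (∈-non-neighbours adj?) (irrefl G) , x-v)
  ... | no x≁v  = inj₁ (from (∈-non-neighbours adj?) x≁v)

  mds-around : ∀ x → ¬ ¬ (∃[ I ] (IsMDS G I × x ∈ I × (∀ {u} → u ∈ I → ¬ Adj G x u)))
  mds-around x none =
    ¬¬-finite-choice (λ v → ¬¬-excluded-middle) λ adj? →
    mds-within (non-neighbours x adj?) (non-neighbours-dominating x adj?) λ (I , I⊆ , I-mds) →
    let no-neighbour : ∀ {u} → u ∈ I → ¬ Adj G x u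
        no-neighbour u∈I = to (∈-non-neighbours adj?) (I⊆ u∈I)
        x∈I : x ∈ I
        x∈I = [ id , (λ (u , u∈I , u-x) → contradiction (sym G u-x) (no-neighbour u∈I)) ]′
                (proj₁ I-mds x)
    in none (I , I-mds , x∈I , no-neighbour)

  nonadjacent-twin-in : ∀ {x s I} → Twins G x s → ¬ Adj G x s → IsMDS G I →
                        (∀ {u} → u ∈ I → ¬ Adj G x u) → s ∈ I
  nonadjacent-twin-in {x} {s} x~s x≁s (dom , _) no-neighbour with dom s
  ... | inj₁ s∈I = s∈I
  ... | inj₂ (u , u∈I , u-s) with u ≟ x
  ...   | yes refl = contradiction u-s x≁s
  ...   | no u≢x   = contradiction (twin-adj G (twins-sym G x~s) (sym G u-s) u≢x)
                                   (no-neighbour u∈I)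

module Equidominating {n} (G : Graph n) (w : Fin n → ℕ) (t : ℕ)
  (characterises : ∀ D → IsMDS G D ⇔ (wsum w D ≡ t)) where

  open ≡-Reasoning

  wsum-exchange : ∀ {D : Subset n} a {b} → b ∉ D →
                  wsum w (exchange D a b) ≡ w b + wsum w (D [ a ]≔ false)
  wsum-exchange {D} a b∉D = wsum-insert w (b∉D ∘ removal-⊆ D a)

  exchange-mds : ∀ {D : Subset n} {a b} → IsMDS G D → a ∈ D → b ∉ D →
                 w a ≡ w b → IsMDS G (exchange D a b)
  exchange-mds {D} {a} {b} D-mds a∈D b∉D wa≡wb = from (characterises _) (begin
    wsum w (exchange D a b)          ≡⟨ wsum-exchange a b∉D ⟩
    w b + wsum w (D [ a ]≔ false)    ≡⟨ cong (_+ wsum w (D [ a ]≔ false)) (≡-sym wa≡wb) ⟩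
    w a + wsum w (D [ a ]≔ false)    ≡⟨ ≡-sym (wsum-remove w a∈D) ⟩
    wsum w D                         ≡⟨ to (characterises D) D-mds ⟩
    t                                ∎)

  exchange-weights : ∀ {D : Subset n} {a b} → IsMDS G D → IsMDS G (exchange D a b) →
                     a ∈ D → b ∉ D → w a ≡ w b
  exchange-weights {D} {a} {b} D-mds E-mds a∈D b∉D =
    +-cancelʳ-≡ (wsum w (D [ a ]≔ false)) (w a) (w b) (begin
      w a + wsum w (D [ a ]≔ false)    ≡⟨ ≡-sym (wsum-remove w a∈D) ⟩
      wsum w D                         ≡⟨ to (characterises D) D-mds ⟩
      t                                ≡⟨ ≡-sym (to (characterises _) E-mds) ⟩
      wsum w (exchange D a b)          ≡⟨ wsum-exchange a b∉D ⟩
      w b + wsum w (D [ a ]≔ false)    ∎)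

  twins-equal-weight : ∀ {D : Subset n} {a b} → Twins G a b →
                       IsMDS G D → a ∈ D → b ∉ D → w a ≡ w b
  twins-equal-weight a~b D-mds a∈D b∉D =
    exchange-weights D-mds (twin-exchange-mds G a~b D-mds a∈D b∉D) a∈D b∉D

  twin-pairs-weights-differ : ∀ {x s y c} →
    Twins G x s → s ≢ x → ¬ Adj G x s → Twins G y c → Adj G y c →
    Adj G x y → Adj G x c → Adj G s y → Adj G s c → w x ≢ w y
  twin-pairs-weights-differ {x} {s} {y} {c} x~s s≢x x≁s y~c y-c x-y x-c s-y s-c wx≡wy =
    mds-around G x λ (I , I-mds , x∈I , no-neighbour) →
    let s∈I = nonadjacent-twin-in G x~s x≁s I-mds no-neighbour
        B-mds = exchange-mds I-mds x∈I (λ y∈I → no-neighbour y∈I x-y) wx≡wy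
        y∈B   = ∈-exchange-new I x y
        s∈B   = ∈-exchange-kept s∈I s≢x (adj⇒≢ G s-y)
        c∉B   = ∉-exchange-kept (λ c∈I → no-neighbour c∈I x-c) (adj⇒≢ G y-c ∘ ≡-sym)
        x∉B   = ∉-exchange-old I (adj⇒≢ G x-y)
        wy≡wc = twins-equal-weight y~c B-mds y∈B c∉B
        ws≡wx = twins-equal-weight (twins-sym G x~s) B-mds s∈B x∉B
        Z-mds = exchange-mds B-mds s∈B c∉B (trans ws≡wx (trans wx≡wy wy≡wc))
        y∈Z   = ∈-exchange-kept y∈B (adj⇒≢ G s-y ∘ ≡-sym) (adj⇒≢ G y-c)
    in  adjacent-twins-not-in-mds G y~c y-c Z-mds y∈Z (∈-exchange-new (exchange I x y) s c)

lemma3p7 : ∀ {n} (G : Graph n) (w : Fin n → ℕ) (t : ℕ) (S C : Subset n) →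
    IsEquidominatingStructure G w t →
    IsStableSetClass G S → IsCliqueClass G C → SeeEachOther G S C →
    ∀ x y → x ∈ S → y ∈ C → w x ≢ w y
lemma3p7 G w t S C (_ , _ , characterises) (S-class , 2≤∣S∣ , S-stable)
         (C-class , 2≤∣C∣ , C-clique) see x y x∈S y∈C wx≡wy =
  another-member S x 2≤∣S∣ x∈S λ (s , s∈S , s≢x) →
  another-member C y 2≤∣C∣ y∈C λ (c , c∈C , c≢y) →
  Equidominating.twin-pairs-weights-differ G w t characterises
    (class-twins G S-class x∈S s∈S) s≢x (S-stable x s x∈S s∈S)
    (class-twins G C-class y∈C c∈C) (C-clique y c y∈C c∈C (c≢y ∘ ≡-sym))
    (see x y x∈S y∈C) (see x c x∈S c∈C) (see s y s∈S y∈C) (see s c s∈S c∈C)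
    wx≡wy
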